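{- Let $n$ be an odd, square-free, composite positive integer, and write $n=p_1p_2\cdots p_t$ with primes $p_1<p_2<\cdots<p_t$. Suppose that $2p_1+2p_2\ge \phi(n)+2$, where $\phi$ is Euler's totient function. Then $t=2$ and $3(p_1+p_2-1)\ge p_1p_2$. -}

module Defs where

open import Data.Nat using (ℕ; suc; _*_; _≟_)
open import Data.Nat.Divisibility using (_∣_)
open import Data.Nat.GCD using (gcd)
open import Data.Nat.Primality using (Prime)
open import Data.List using (List; length; filter; upTo; map)
open import Relation.Binary.PropositionalEquality using (_≡_)
open import Relation.Nullary using (¬_)

φ : ℕ → ℕ
φ n = length (filter (λ k → gcd k n ≟ 1) (map suc (upTo n)))

SquareFree : ℕ → Set
SquareFree n = ∀ p → Prime p → ¬ (p * p ∣ n)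

Odd : ℕ → Set
Odd n = ¬ (2 ∣ n)

-- Both claims follow from lower bounds on φ(n) proved by counting.  A
-- k ∈ [1, n] not coprime to n is divisible by some pᵢ, so along any list
-- of numbers in [1, n] the coprime ones number at least the length minus
-- Σᵢ #(multiples of pᵢ in the list) (union bound).  If the multiples of
-- p along a sequence occur at indices differing by multiples of p, then
-- c·p consecutive terms contain at most c of them.  Applied to
--   • [1, ab − 1] for n = ab:  φ(ab) ≥ ab − 1 − (b − 1) − (a − 1);
--   • 1 + jM (j < abc) for n = abcM, t ≥ 3, whose terms are prime to M:
--     φ(n) ≥ abc − bc − ac − ab.
-- The hypothesis then gives 3(a + b − 1) ≥ ab when t = 2, and, as a ≥ 3
-- (n is odd), contradicts a polynomial inequality when t ≥ 3.
module Submission where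

open import Defs
open import Data.Nat using (ℕ; zero; suc; _+_; _*_; _∸_; _≥_; _<_; _≤_; _≟_; z≤n; s≤s; z<s; NonZero)
open import Data.Nat.Properties
open import Data.Nat.Divisibility using (_∣_; _∣?_; _∣0; ∣-refl; ∣-trans; ∣1⇒≡1; ∣⇒≤; ∣m+n∣m⇒∣n; ∣n⇒∣m*n; m∣m*n)
open import Data.Nat.Primality using (Prime; Composite; euclidsLemma; prime⇒irreducible; prime⇒nonZero; prime⇒nonTrivial; productOfPrimes≢0)
open import Data.Nat.Coprimality using (Coprime; coprime-divisor; coprime⇒gcd≡1)
open import Data.Nat.GCD using (gcd)
open import Data.Nat.Base using (>-nonZero⁻¹; nonTrivial⇒n>1; nonTrivial⇒≢1)
open import Data.Nat.ListAction using (sum; product)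
open import Data.Nat.ListAction.Properties using (∈⇒∣product)
open import Data.Nat.Tactic.RingSolver using (solve-∀)
open import Data.List using (List; []; _∷_; _++_; length; map; filter; applyUpTo; upTo)
open import Data.List.Properties using (length-++; filter-++; filter-all; filter-none; filter-accept; length-applyUpTo; map-upTo)
open import Data.List.Membership.Propositional using (find)
open import Data.List.Relation.Unary.All as All using (All; []; _∷_)
open import Data.List.Relation.Unary.All.Properties using (¬Any⇒All¬; applyUpTo⁺₁; applyUpTo⁺₂)
open import Data.List.Relation.Unary.Any using (Any; here; there; any?)
open import Data.List.Relation.Unary.Any.Properties using (++⁻)
open import Data.List.Relation.Unary.Linked using (Linked)
open import Data.List.Relation.Unary.Linked.Properties using (Linked⇒AllPairs)
open import Data.List.Relation.Unary.AllPairs using (_∷_)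
open import Data.List.Relation.Binary.Sublist.Propositional using (_⊆_; []; _∷_; _∷ʳ_; ⊆-refl; ⊆-trans)
open import Data.List.Relation.Binary.Sublist.Propositional.Properties using (filter⁺; length-mono-≤; []⊆-universal)
open import Data.Product using (_×_; _,_)
open import Data.Sum using (_⊎_; inj₁; inj₂; [_,_]′)
open import Data.Empty using (⊥-elim)
open import Function using (_∘_; id)
open import Relation.Nullary using (¬_; yes; no; contradiction)
open import Relation.Unary using (Decidable)
open import Relation.Unary.Properties using (_∪?_)
open import Relation.Binary.PropositionalEquality

count : {A : Set} {P : A → Set} → Decidable P → List A → ℕ
count P? xs = length (filter P? xs)

module _ {A : Set} {P : A → Set} (P? : Decidable P) where

  count-⊆ : {xs ys : List A} → xs ⊆ ys → count P? xs ≤ count P? ys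
  count-⊆ xs⊆ys = length-mono-≤ (filter⁺ P? P? (λ { refl px → px }) xs⊆ys)

  count-++ : (xs ys : List A) → count P? (xs ++ ys) ≡ count P? xs + count P? ys
  count-++ xs ys = trans (cong length (filter-++ P? xs ys)) (length-++ (filter P? xs))

  count-accept : {x : A} {xs : List A} → P x → count P? (x ∷ xs) ≡ suc (count P? xs)
  count-accept px = cong length (filter-accept P? px)

  count-all : {xs : List A} → All P xs → count P? xs ≡ length xs
  count-all all = cong length (filter-all P? all)

  count-none : {xs : List A} → All (¬_ ∘ P) xs → count P? xs ≡ 0
  count-none none = cong length (filter-none P? none)

count-∪ : {A : Set} {P Q : A → Set} (P? : Decidable P) (Q? : Decidable Q) (xs : List A) →
          count (P? ∪? Q?) xs ≤ count P? xs + count Q? xs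
count-∪ P? Q? [] = z≤n
count-∪ P? Q? (x ∷ xs) with P? x | Q? x
... | yes _ | yes _ = s≤s (≤-trans (count-∪ P? Q? xs) (+-monoʳ-≤ _ (n≤1+n _)))
... | yes _ | no _  = s≤s (count-∪ P? Q? xs)
... | no _  | yes _ = ≤-trans (s≤s (count-∪ P? Q? xs)) (≤-reflexive (sym (+-suc _ _)))
... | no _  | no _  = count-∪ P? Q? xs

divisorHits : List ℕ → List ℕ → ℕ
divisorHits ps xs = sum (map (λ p → count (p ∣?_) xs) ps)

-- By induction on ps, absorbing the multiples of p into the predicate.
union-bound : {C : ℕ → Set} (C? : Decidable C) (ps xs : List ℕ) →
              All (λ x → ¬ C x → Any (_∣ x) ps) xs →
              length xs ≤ count C? xs + divisorHits ps xs
union-bound {C} C? [] xs covered =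
  ≤-reflexive (sym (trans (+-identityʳ _) (count-all C? (All.map holds covered))))
  where
  holds : ∀ {x} → (¬ C x → Any (_∣ x) []) → C x
  holds {x} h with C? x
  ... | yes c = c
  ... | no ¬c with () ← h ¬c
union-bound {C} C? (p ∷ ps) xs covered = begin
  length xs
    ≤⟨ union-bound (C? ∪? (p ∣?_)) ps xs (All.map uncovered covered) ⟩
  count (C? ∪? (p ∣?_)) xs + divisorHits ps xs
    ≤⟨ +-monoˡ-≤ _ (count-∪ C? (p ∣?_) xs) ⟩
  count C? xs + count (p ∣?_) xs + divisorHits ps xs
    ≡⟨ +-assoc (count C? xs) _ _ ⟩
  count C? xs + divisorHits (p ∷ ps) xs ∎
  where
  open ≤-Reasoning
  uncovered : ∀ {x} → (¬ C x → Any (_∣ x) (p ∷ ps)) → ¬ (C x ⊎ p ∣ x) → Any (_∣ x) ps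
  uncovered h ¬C∪p with h (¬C∪p ∘ inj₁)
  ... | here p∣x = contradiction (inj₂ p∣x) ¬C∪p
  ... | there hit = hit

coprime-to-prime : ∀ {x p} → Prime p → ¬ p ∣ x → Coprime x p
coprime-to-prime pp p∤x (d∣x , d∣p) with prime⇒irreducible pp d∣p
... | inj₁ d≡1 = d≡1
... | inj₂ refl = contradiction d∣x p∤x

coprime-* : ∀ {x m k} → Coprime x m → Coprime x k → Coprime x (m * k)
coprime-* {x} {m} x⊥m x⊥k {d} (d∣x , d∣mk) = x⊥k (d∣x , coprime-divisor d⊥m d∣mk)
  where
  d⊥m : Coprime d m
  d⊥m (e∣d , e∣m) = x⊥m (∣-trans e∣d d∣x , e∣m)

coprime-product : ∀ {x} ps → All Prime ps → All (λ p → ¬ p ∣ x) ps → Coprime x (product ps)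
coprime-product [] [] [] (_ , d∣1) = ∣1⇒≡1 d∣1
coprime-product (p ∷ ps) (pp ∷ pps) (p∤x ∷ ps∤x) =
  coprime-* (coprime-to-prime pp p∤x) (coprime-product ps pps ps∤x)

noncoprime⇒prime-divisor : ∀ {x n} ps → All Prime ps → product ps ≡ n →
                           ¬ gcd x n ≡ 1 → Any (_∣ x) ps
noncoprime⇒prime-divisor {x} ps pps refl ¬x⊥n with any? (_∣? x) ps
... | yes hit = hit
... | no ¬hit = contradiction (coprime⇒gcd≡1 (coprime-product ps pps (¬Any⇒All¬ ps ¬hit))) ¬x⊥n

prime∤product-of-larger : ∀ {p} qs → Prime p → All Prime qs → All (p <_) qs → ¬ p ∣ product qs
prime∤product-of-larger {p} qs pp pqs p<qs p∣Q =
  nonTrivial⇒≢1 {{prime⇒nonTrivial pp}} (p⊥Q (∣-refl , p∣Q))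
  where
  p⊥Q : Coprime p (product qs)
  p⊥Q = coprime-product qs pqs
          (All.map (λ p<q q∣p → <⇒≱ p<q (∣⇒≤ {{prime⇒nonZero pp}} q∣p)) p<qs)

odd-prime-factor≥3 : ∀ {p n} → Prime p → p ∣ n → Odd n → 3 ≤ p
odd-prime-factor≥3 {p} pp p∣n odd =
  ≤∧≢⇒< (nonTrivial⇒n>1 p {{prime⇒nonTrivial pp}}) (λ 2≡p → odd (subst (_∣ _) (sym 2≡p) p∣n))

applyUpTo-++ : {A : Set} (f : ℕ → A) (m n : ℕ) →
               applyUpTo f (m + n) ≡ applyUpTo f m ++ applyUpTo (f ∘ (m +_)) n
applyUpTo-++ f zero n = refl
applyUpTo-++ f (suc m) n = cong (f 0 ∷_) (applyUpTo-++ (f ∘ suc) m n)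

applyUpTo-prefix : {A : Set} (f : ℕ → A) {m n : ℕ} → m ≤ n → applyUpTo f m ⊆ applyUpTo f n
applyUpTo-prefix f z≤n = []⊆-universal _
applyUpTo-prefix f (s≤s m≤n) = refl ∷ applyUpTo-prefix (f ∘ suc) m≤n

applyUpTo-suffix : {A : Set} (f : ℕ → A) (m n : ℕ) → applyUpTo (f ∘ (m +_)) n ⊆ applyUpTo f (m + n)
applyUpTo-suffix f zero n = ⊆-refl
applyUpTo-suffix f (suc m) n = f 0 ∷ʳ applyUpTo-suffix (f ∘ suc) m n

applyUpTo-sample : {A : Set} (g : ℕ → A) (M : ℕ) .{{_ : NonZero M}} (R : ℕ) →
                   applyUpTo (λ j → g (j * M)) R ⊆ applyUpTo g (R * M)
applyUpTo-sample g (suc M) zero = []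
applyUpTo-sample g (suc M) (suc R) =
  refl ∷ ⊆-trans (applyUpTo-sample (g ∘ (suc M +_)) (suc M) R)
                 (applyUpTo-suffix (g ∘ suc) M (R * suc M))

Spaced : (ℕ → Set) → (ℕ → ℕ) → ℕ → Set
Spaced P f p = ∀ {i j} → i < j → P (f i) → P (f j) → p ∣ j ∸ i

spaced-shift : ∀ {P f p} k → Spaced P f p → Spaced P (f ∘ (k +_)) p
spaced-shift {p = p} k spaced {i} {j} i<j hitᵢ hitⱼ =
  subst (p ∣_) ([m+n]∸[m+o]≡n∸o k j i) (spaced (+-monoʳ-< k i<j) hitᵢ hitⱼ)

-- Distinct hits of a p-spaced predicate are at least p apart, so a window
-- of at most p consecutive terms contains at most one hit.
count-window : ∀ {P} (P? : Decidable P) {f p} → Spaced P f p →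
               ∀ {m} → m ≤ p → count P? (applyUpTo f m) ≤ 1
count-window P? spaced {zero} _ = z≤n
count-window {P} P? {f} {p} spaced {suc m} m<p with P? (f 0)
... | yes hit₀ = s≤s (≤-reflexive (count-none P? (applyUpTo⁺₁ (f ∘ suc) m miss)))
  where
  miss : ∀ {i} → i < m → ¬ P (f (suc i))
  miss i<m hit = <⇒≱ (≤-trans (s≤s i<m) m<p) (∣⇒≤ (spaced z<s hit₀ hit))
... | no _ = count-window P? (spaced-shift {P} {f} 1 spaced) (≤-trans (n≤1+n m) m<p)

count-spaced : ∀ {P} (P? : Decidable P) {f p} → Spaced P f p →
               ∀ c → count P? (applyUpTo f (c * p)) ≤ c
count-spaced P? spaced zero = z≤n
count-spaced {P} P? {f} {p} spaced (suc c) = begin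
  count P? (applyUpTo f (p + c * p))
    ≡⟨ cong (count P?) (applyUpTo-++ f p (c * p)) ⟩
  count P? (applyUpTo f p ++ applyUpTo (f ∘ (p +_)) (c * p))
    ≡⟨ count-++ P? (applyUpTo f p) _ ⟩
  count P? (applyUpTo f p) + count P? (applyUpTo (f ∘ (p +_)) (c * p))
    ≤⟨ +-mono-≤ (count-window P? spaced ≤-refl) (count-spaced P? (spaced-shift {P} {f} p spaced) c) ⟩
  suc c ∎
  where open ≤-Reasoning

multiples-spaced : ∀ p → Spaced (p ∣_) id p
multiples-spaced p i<j p∣i p∣j =
  ∣m+n∣m⇒∣n (subst (p ∣_) (sym (m+[n∸m]≡n (<⇒≤ i<j))) p∣j) p∣i

multiples-below : ∀ {p k L} → suc L ≡ k * p → suc (count (p ∣?_) (applyUpTo suc L)) ≤ k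
multiples-below {p} {k} {L} kp≡ = begin
  suc (count (p ∣?_) (applyUpTo suc L)) ≡⟨ count-accept (p ∣?_) (p ∣0) ⟨
  count (p ∣?_) (upTo (suc L))          ≡⟨ cong (count (p ∣?_) ∘ upTo) kp≡ ⟩
  count (p ∣?_) (upTo (k * p))          ≤⟨ count-spaced (p ∣?_) (multiples-spaced p) k ⟩
  k ∎
  where open ≤-Reasoning

progression : ℕ → ℕ → List ℕ
progression M R = applyUpTo (λ j → suc (j * M)) R

-- For a prime p not dividing M, multiples of p along the progression are
-- p-spaced: p ∣ (j − i)M forces p ∣ j − i.
progression-spaced : ∀ {p M} → Prime p → ¬ p ∣ M → Spaced (p ∣_) (λ j → suc (j * M)) p
progression-spaced {p} {M} pp p∤M {i} {j} i<j p∣termᵢ p∣termⱼ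
  with euclidsLemma (j ∸ i) M pp p∣gap
  where
  termⱼ≡ : suc (j * M) ≡ suc (i * M) + (j ∸ i) * M
  termⱼ≡ = cong suc (trans (cong (_* M) (sym (m+[n∸m]≡n (<⇒≤ i<j)))) (*-distribʳ-+ M i (j ∸ i)))
  p∣gap : p ∣ (j ∸ i) * M
  p∣gap = ∣m+n∣m⇒∣n (subst (p ∣_) termⱼ≡ p∣termⱼ) p∣termᵢ
... | inj₁ p∣j∸i = p∣j∸i
... | inj₂ p∣M = contradiction p∣M p∤M

progression-multiples : ∀ {p M R} k → Prime p → ¬ p ∣ M → R ≡ k * p →
                        count (p ∣?_) (progression M R) ≤ k
progression-multiples k pp p∤M refl = count-spaced _ (progression-spaced pp p∤M) k

-- No prime factor of M divides a term of the progression, as each is 1 mod M.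
progression-avoids-factors : ∀ {rs} → All Prime rs → ∀ j → ¬ Any (_∣ suc (j * product rs)) rs
progression-avoids-factors {rs} prs j hit with find hit
... | r , r∈rs , r∣term =
  nonTrivial⇒≢1 {{prime⇒nonTrivial (All.lookup prs r∈rs)}}
    (∣1⇒≡1 (∣m+n∣m⇒∣n (subst (r ∣_) (+-comm 1 (j * product rs)) r∣term)
                      (∣n⇒∣m*n j (∈⇒∣product r∈rs))))

coprime? : (n : ℕ) → Decidable (λ k → gcd k n ≡ 1)
coprime? n k = gcd k n ≟ 1

φ-≥-sublist : ∀ {n xs} → xs ⊆ applyUpTo suc n → count (coprime? n) xs ≤ φ n
φ-≥-sublist {n} xs⊆ =
  ≤-trans (count-⊆ (coprime? n) xs⊆) (≤-reflexive (cong (count (coprime? n)) (sym (map-upTo suc n))))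

-- φ(ab) ≥ ab − a − b + 1 for primes a, b: count [1, ab − 1] minus the
-- b − 1 multiples of a and the a − 1 multiples of b.
two-prime-totient : ∀ {a b} → Prime a → Prime b → a * b + 1 ≤ φ (a * b) + a + b
two-prime-totient {a} {b} pa pb = begin
  a * b + 1                           ≡⟨ cong (_+ 1) L+1≡n ⟨
  suc L + 1                           ≤⟨ +-monoˡ-≤ 1 (s≤s covered) ⟩
  suc (#coprime + (#b + (#a + 0))) + 1 ≡⟨ rearrange #coprime #b #a ⟩
  #coprime + suc #b + suc #a          ≤⟨ +-mono-≤ (+-mono-≤ #coprime≤φ #b<a) #a<b ⟩
  φ n + a + b ∎
  where
  open ≤-Reasoning
  n L : ℕ
  n = a * b
  L = n ∸ 1
  xs : List ℕ
  xs = applyUpTo suc L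
  #coprime #a #b : ℕ
  #coprime = count (coprime? n) xs
  #a = count (a ∣?_) xs
  #b = count (b ∣?_) xs
  L+1≡n : suc L ≡ n
  L+1≡n = m+[n∸m]≡n (>-nonZero⁻¹ n {{m*n≢0 a b {{prime⇒nonZero pa}} {{prime⇒nonZero pb}}}})
  covered : L ≤ #coprime + (#b + (#a + 0))
  covered = subst (_≤ #coprime + (#b + (#a + 0))) (length-applyUpTo suc L)
              (union-bound (coprime? n) (b ∷ a ∷ []) xs
                (All.universal (λ _ → noncoprime⇒prime-divisor (b ∷ a ∷ []) (pb ∷ pa ∷ [])
                                        (trans (cong (b *_) (*-identityʳ a)) (*-comm b a))) xs))
  #coprime≤φ : #coprime ≤ φ n
  #coprime≤φ = φ-≥-sublist (applyUpTo-prefix suc (subst (L ≤_) L+1≡n (n≤1+n L)))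
  #b<a : suc #b ≤ a
  #b<a = multiples-below L+1≡n
  #a<b : suc #a ≤ b
  #a<b = multiples-below (trans L+1≡n (*-comm a b))
  rearrange : ∀ x y z → suc (x + (y + (z + 0))) + 1 ≡ x + suc y + suc z
  rearrange = solve-∀

-- φ(abcM) ≥ abc − bc − ac − ab when a, b, c are primes not dividing the
-- product M of further primes: count the progression 1 + jM, j < abc.
three-prime-totient : ∀ a b c rest → All Prime (a ∷ b ∷ c ∷ rest) →
                      All (λ p → ¬ p ∣ product rest) (a ∷ b ∷ c ∷ []) →
                      a * (b * c) ≤ φ (product (a ∷ b ∷ c ∷ rest)) + (b * c + (a * c + (a * b + 0)))
three-prime-totient a b c rest primes@(pa ∷ pb ∷ pc ∷ prest) (a∤M ∷ b∤M ∷ c∤M ∷ []) = begin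
  R                                            ≡⟨ length-applyUpTo _ R ⟨
  length xs                                    ≤⟨ union-bound (coprime? n) (a ∷ b ∷ c ∷ []) xs covered ⟩
  count (coprime? n) xs + divisorHits (a ∷ b ∷ c ∷ []) xs
    ≤⟨ +-mono-≤ (φ-≥-sublist sampled)
         (+-mono-≤ (progression-multiples (b * c) pa a∤M (*-comm a (b * c)))
           (+-mono-≤ (progression-multiples (a * c) pb b∤M R≡ac·b)
             (+-mono-≤ (progression-multiples (a * b) pc c∤M (sym (*-assoc a b c))) z≤n))) ⟩
  φ n + (b * c + (a * c + (a * b + 0))) ∎
  where
  open ≤-Reasoning
  M n R : ℕ
  M = product rest
  n = product (a ∷ b ∷ c ∷ rest)
  R = a * (b * c)
  xs : List ℕ
  xs = progression M R
  instance
    M≢0 : NonZero M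
    M≢0 = productOfPrimes≢0 prest
  R≡ac·b : R ≡ a * c * b
  R≡ac·b = trans (cong (a *_) (*-comm b c)) (sym (*-assoc a c b))
  sampled : xs ⊆ applyUpTo suc n
  sampled = subst (λ m → xs ⊆ applyUpTo suc m)
                  (trans (*-assoc a (b * c) M) (cong (a *_) (*-assoc b c M)))
                  (applyUpTo-sample suc M R)
  covered : All (λ x → ¬ gcd x n ≡ 1 → Any (_∣ x) (a ∷ b ∷ c ∷ [])) xs
  covered = applyUpTo⁺₂ _ R (λ j ¬coprime →
              [ id , (λ hit → contradiction hit (progression-avoids-factors prest j)) ]′
                (++⁻ (a ∷ b ∷ c ∷ []) (noncoprime⇒prime-divisor (a ∷ b ∷ c ∷ rest) primes refl ¬coprime)))

two-prime-arithmetic : ∀ {a b f} → a * b + 1 ≤ f + a + b → f + 2 ≤ 2 * a + 2 * b →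
                       a * b ≤ 3 * (a + b ∸ 1)
two-prime-arithmetic {a} {b} {f} totient hyp =
  subst (a * b ≤_) (sym (*-distribˡ-∸ 3 (a + b) 1)) (m+n≤o⇒m≤o∸n (a * b) bound)
  where
  open ≤-Reasoning
  shuffle : ∀ f a b → f + a + b + 2 ≡ f + 2 + (a + b)
  shuffle = solve-∀
  collect : ∀ a b → 2 * a + 2 * b + (a + b) ≡ 3 * (a + b)
  collect = solve-∀
  bound : a * b + 3 ≤ 3 * (a + b)
  bound = begin
    a * b + 3               ≡⟨ +-assoc (a * b) 1 2 ⟨
    a * b + 1 + 2           ≤⟨ +-monoˡ-≤ 2 totient ⟩
    f + a + b + 2           ≡⟨ shuffle f a b ⟩
    f + 2 + (a + b)         ≤⟨ +-monoˡ-≤ (a + b) hyp ⟩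
    2 * a + 2 * b + (a + b) ≡⟨ collect a b ⟩
    3 * (a + b)             ∎

-- With a = 3 + x, b = a + 1 + y, c = b + 1 + z the
-- difference is a polynomial in x, y, z with nonnegative coefficients.
cubic-bound : ∀ {a b c} → 3 ≤ a → a < b → b < c →
              b * c + (a * c + (a * b + 0)) + (2 * a + 2 * b) ≤ a * (b * c) + 1
cubic-bound 3≤a a<b b<c with m≤n⇒∃[o]m+o≡n 3≤a | m≤n⇒∃[o]m+o≡n a<b | m≤n⇒∃[o]m+o≡n b<c
... | x , refl | y , refl | z , refl = ≤-trans (m≤m+n _ _) (≤-reflexive (sym (expansion x y z)))
  where
  expansion : ∀ x y z →
    (3 + x) * ((4 + x + y) * (5 + x + y + z)) + 1
      ≡ (4 + x + y) * (5 + x + y + z) + ((3 + x) * (5 + x + y + z) + ((3 + x) * (4 + x + y) + 0))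
        + (2 * (3 + x) + 2 * (4 + x + y))
        + (19 * x + 10 * y + 5 * z + 9 * (x * x) + 11 * (x * y) + 5 * (x * z)
           + 2 * (y * y) + 2 * (y * z) + x * x * x + 2 * (x * x * y) + x * x * z
           + x * y * y + x * y * z)
  expansion = solve-∀

three-prime-contradiction : ∀ {a b c f} → 3 ≤ a → a < b → b < c →
                            a * (b * c) ≤ f + (b * c + (a * c + (a * b + 0))) →
                            ¬ (f + 2 ≤ 2 * a + 2 * b)
three-prime-contradiction {a} {b} {c} {f} 3≤a a<b b<c totient hyp = <-irrefl refl (begin
  suc (a * (b * c) + 1) ≡⟨ +-suc (a * (b * c)) 1 ⟨
  a * (b * c) + 2       ≤⟨ +-monoˡ-≤ 2 totient ⟩
  f + T + 2             ≡⟨ swap f T 2 ⟩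
  f + 2 + T             ≤⟨ +-monoˡ-≤ T hyp ⟩
  2 * a + 2 * b + T     ≡⟨ +-comm (2 * a + 2 * b) T ⟩
  T + (2 * a + 2 * b)   ≤⟨ cubic-bound 3≤a a<b b<c ⟩
  a * (b * c) + 1       ∎)
  where
  open ≤-Reasoning
  T : ℕ
  T = b * c + (a * c + (a * b + 0))
  swap : ∀ x y z → x + y + z ≡ x + z + y
  swap = solve-∀

lemma2p2 : (n : ℕ) → Odd n → SquareFree n → Composite n →
           (p₁ p₂ : ℕ) (rest : List ℕ) →
           All Prime (p₁ ∷ p₂ ∷ rest) → Linked _<_ (p₁ ∷ p₂ ∷ rest) →
           product (p₁ ∷ p₂ ∷ rest) ≡ n →
           2 * p₁ + 2 * p₂ ≥ φ n + 2 →
           (rest ≡ []) × (3 * (p₁ + p₂ ∸ 1) ≥ p₁ * p₂)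
lemma2p2 _ _ _ _ a b [] (pa ∷ pb ∷ []) _ refl hyp =
  refl , two-prime-arithmetic (two-prime-totient pa pb) hyp′
  where
  hyp′ : φ (a * b) + 2 ≤ 2 * a + 2 * b
  hyp′ = subst (λ m → φ (a * m) + 2 ≤ 2 * a + 2 * b) (*-identityʳ b) hyp
lemma2p2 _ odd _ _ a b (c ∷ rest) primes@(pa ∷ pb ∷ pc ∷ prest) sorted refl hyp
  with Linked⇒AllPairs <-trans sorted
... | (a<b ∷ _ ∷ a<rest) ∷ (b<c ∷ b<rest) ∷ (c<rest ∷ _) =
  ⊥-elim (three-prime-contradiction 3≤a a<b b<c (three-prime-totient a b c rest primes abc∤M) hyp)
  where
  3≤a : 3 ≤ a
  3≤a = odd-prime-factor≥3 pa (m∣m*n _) odd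
  abc∤M : All (λ p → ¬ p ∣ product rest) (a ∷ b ∷ c ∷ [])
  abc∤M = prime∤product-of-larger rest pa prest a<rest
        ∷ prime∤product-of-larger rest pb prest b<rest
        ∷ prime∤product-of-larger rest pc prest c<rest ∷ []
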